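{- Let $t$ be a positive integer and let $p_1(x_1,\ldots,x_t)$, $p_2(x_1,\ldots,x_t)$ be polynomials with integer coefficients. Suppose there exist integers $s_1,s_2\ge 1$, matrices $A_1,M_1,N_1,B_1\in\mathbb{Z}^{s_1\times s_1}_{\rm uptr}$ and $A_2,M_2,N_2,B_2\in\mathbb{Z}^{s_2\times s_2}_{\rm uptr}$ such that for all $a_1,\ldots,a_t\in\mathbb{N}$, \[A_1M_1^{a_1}N_1M_1^{a_2}N_1\cdots N_1M_1^{a_t}B_1=p_1(a_1,\ldots,a_t)E_{s_1}\] and \[A_2M_2^{a_1}N_2M_2^{a_2}N_2\cdots N_2M_2^{a_t}B_2=p_2(a_1,\ldots,a_t)E_{s_2}.\] Then: (i) there exist $s_3\ge1$ and $A_3,M_3,N_3,B_3\in\mathbb{Z}^{s_3\times s_3}_{\rm uptr}$ such that $A_3M_3^{a_1}N_3M_3^{a_2}N_3\cdots N_3M_3^{a_t}B_3=(p_1+p_2)(a_1,\ldots,a_t)E_{s_3}$ for all $a_1,\ldots,a_t\in\mathbb{N}$; (ii) there exist $s_4\ge1$ and $A_4,M_4,N_4,B_4\in\mathbb{Z}^{s_4\times s_4}_{\rm uptr}$ such that $A_4M_4^{a_1}N_4M_4^{a_2}N_4\cdots N_4M_4^{a_t}B_4=(p_1p_2)(a_1,\ldots,a_t)E_{s_4}$ for all $a_1,\ldots,a_t\in\mathbb{N}$; (iii) for every $c\in\mathbb{Z}$ there exists $A_5\in\mathbb{Z}^{s_1\times s_1}_{\rm uptr}$ such that $A_5M_1^{a_1}N_1M_1^{a_2}N_1\cdots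 N_1M_1^{a_t}B_1=c\,p_1(a_1,\ldots,a_t)E_{s_1}$ for all $a_1,\ldots,a_t\in\mathbb{N}$.
   Context: $\mathbb{Z}^{k\times k}_{\rm uptr}$ is the set of upper-triangular $k\times k$ integer matrices. $E_k$ is the $k\times k$ matrix whose only nonzero entry is the entry in row $1$, column $k$, which equals $1$. $\mathbb{N}$ is the set of nonnegative integers and $M^0$ is the identity matrix. -}

module Defs where

open import Data.Nat as ℕ using (ℕ; zero; suc)
open import Data.Integer using (ℤ; +_; _+_; _*_)
open import Data.Fin using (Fin; zero; suc; fromℕ; toℕ)
open import Data.Fin.Properties using (_≟_)
import Data.Nat as N
open import Data.Vec using (Vec; []; _∷_; lookup)
open import Relation.Binary.PropositionalEquality using (_≡_)
open import Relation.Nullary using (yes; no)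

Mat : ℕ → Set
Mat k = Fin k → Fin k → ℤ

∑ : ∀ {k} → (Fin k → ℤ) → ℤ
∑ {zero}  f = + 0
∑ {suc k} f = f zero + ∑ (λ j → f (suc j))

infixl 7 _⊗_
_⊗_ : ∀ {k} → Mat k → Mat k → Mat k
(A ⊗ B) i j = ∑ (λ l → A i l * B l j)

I : ∀ {k} → Mat k
I i j with i ≟ j
... | yes _ = + 1
... | no _  = + 0

_^_ : ∀ {k} → Mat k → ℕ → Mat k
M ^ zero  = I
M ^ suc n = (M ^ n) ⊗ M

_·_ : ∀ {k} → ℤ → Mat k → Mat k
(c · A) i j = c * A i j

_≈_ : ∀ {k} → Mat k → Mat k → Set
A ≈ B = ∀ i j → A i j ≡ B i j

UpperTri : ∀ {k} → Mat k → Set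
UpperTri A = ∀ i j → toℕ j N.< toℕ i → A i j ≡ + 0

-- E_s for s = suc n: only nonzero entry is (row 1, column s) = 1
E : (n : ℕ) → Mat (suc n)
E n zero j with j ≟ fromℕ n
... | yes _ = + 1
... | no _  = + 0
E n (suc i) j = + 0

word : ∀ {k t} → Mat k → Mat k → Vec ℕ (suc t) → Mat k
word M N (a ∷ [])     = M ^ a
word M N (a ∷ b ∷ as) = (M ^ a) ⊗ N ⊗ word M N (b ∷ as)

data Poly (t : ℕ) : Set where
  con  : ℤ → Poly t
  var  : Fin t → Poly t
  _:+_ : Poly t → Poly t → Poly t
  _:*_ : Poly t → Poly t → Poly t

eval : ∀ {t} → Poly t → Vec ℕ t → ℤ
eval (con c)  a = c
eval (var i)  a = + lookup a i
eval (p :+ q) a = eval p a + eval q a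
eval (p :* q) a = eval p a * eval q a

Represents : ∀ {t} (n : ℕ) → Mat (suc n) → Mat (suc n) → Mat (suc n) → Mat (suc n)
           → Poly (suc t) → Set
Represents {t} n A M N B p =
  (a : Vec ℕ (suc t)) → (A ⊗ word M N a ⊗ B) ≈ (eval p a · E n)

AllUT : ∀ {k} → Mat k → Mat k → Mat k → Mat k → Set
AllUT A M N B = UpperTri A Data.Product.× UpperTri M Data.Product.× UpperTri N Data.Product.× UpperTri B
  where import Data.Product

module Submission where

-- A representation  A·W(a)·B = p(a)·E  (W(a) the word in M, N)
-- only depends on the first row u of A and the last column v of B: it is
-- equivalent to the scalar identity  u W(a) v = p(a)  for the bilinear form
-- u W v  (lemmas extract-form and realise-form; the matrices realising a form
-- are upper triangular because they are supported on the first row, resp. the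
-- last column).  So everything reduces to forms:
--   (i)   for the direct sum M₁ ⊕ M₂, the concatenated vectors give
--         (u₁ ++ u₂)(W₁ ⊕ W₂)(v₁ ++ v₂) = u₁W₁v₁ + u₂W₂v₂;
--   (ii)  for the Kronecker product M₁ ⊠ M₂, the tensor vectors give
--         (u₁ ⊗ᵥ u₂)(W₁ ⊠ W₂)(v₁ ⊗ᵥ v₂) = (u₁W₁v₁)(u₂W₂v₂);
--   (iii) scaling A by c scales the whole product.
-- In (i) and (ii) words are computed blockwise, since ⊕ and ⊠ are
-- multiplicative and send I to I (lemma word-hom), and both constructions
-- preserve upper triangularity.

open import Defs
open import Data.Nat as ℕ using (ℕ; zero; suc)
import Data.Nat.Properties as ℕP
open import Data.Integer using (ℤ; +_; _+_; _*_)
import Data.Integer.Properties as ℤP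
open import Data.Integer.Tactic.RingSolver using (solve-∀)
open import Data.Fin using (Fin; zero; suc; fromℕ; toℕ; splitAt; join; remQuot; quotRem; combine)
open import Data.Fin.Properties as FinP using (_≟_)
open import Data.Product as Product using (Σ; _×_; _,_; proj₁; proj₂)
open import Data.Sum as Sum using (_⊎_; inj₁; inj₂; [_,_]′)
open import Data.Vec using (Vec; []; _∷_)
open import Data.Vec.Functional using (Vector; _++_)
open import Data.Empty using (⊥-elim)
open import Function using (_∘_)
open import Relation.Binary.Definitions using (tri<; tri≈; tri>)
open import Relation.Binary.PropositionalEquality
open import Relation.Nullary using (yes; no)

∑-cong : ∀ {k} {f g : Vector ℤ k} → (∀ l → f l ≡ g l) → ∑ f ≡ ∑ g
∑-cong {zero}  e = refl
∑-cong {suc k} e = cong₂ _+_ (e zero) (∑-cong (λ l → e (suc l)))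

∑-0 : ∀ k → ∑ {k} (λ _ → + 0) ≡ + 0
∑-0 zero    = refl
∑-0 (suc k) = trans (ℤP.+-identityˡ _) (∑-0 k)

∑-*ˡ : ∀ {k} (c : ℤ) (f : Vector ℤ k) → ∑ (λ l → c * f l) ≡ c * ∑ f
∑-*ˡ {zero}  c f = sym (ℤP.*-zeroʳ c)
∑-*ˡ {suc k} c f = trans (cong (λ z → c * f zero + z) (∑-*ˡ c (λ l → f (suc l))))
                         (sym (ℤP.*-distribˡ-+ c (f zero) _))

∑-*ʳ : ∀ {k} (c : ℤ) (f : Vector ℤ k) → ∑ (λ l → f l * c) ≡ ∑ f * c
∑-*ʳ c f = trans (∑-cong (λ l → ℤP.*-comm (f l) c)) (trans (∑-*ˡ c f) (ℤP.*-comm c _))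

∑-*0 : ∀ {k} (f : Vector ℤ k) → ∑ (λ l → f l * + 0) ≡ + 0
∑-*0 f = trans (∑-*ʳ (+ 0) f) (ℤP.*-zeroʳ (∑ f))

∑-splitAt : ∀ m {n} (g : Fin m ⊎ Fin n → ℤ) →
  ∑ (λ x → g (splitAt m x)) ≡ ∑ (λ i → g (inj₁ i)) + ∑ (λ j → g (inj₂ j))
∑-splitAt zero    g = sym (ℤP.+-identityˡ _)
∑-splitAt (suc m) g = trans (cong (λ z → g (inj₁ zero) + z) (∑-splitAt m (λ s → g (Sum.map₁ suc s))))
                            (sym (ℤP.+-assoc (g (inj₁ zero)) _ _))

-- On Fin (suc m * n), remQuot first splits off the block of the n indices
-- with quotient zero, so the induction step is an instance of ∑-splitAt.
∑-remQuot : ∀ m n (g : Fin m × Fin n → ℤ) →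
  ∑ (λ x → g (remQuot n x)) ≡ ∑ (λ i → ∑ (λ j → g (i , j)))
∑-remQuot zero    n g = refl
∑-remQuot (suc m) n g =
  trans (∑-splitAt n (λ s → g (Product.swap ([ (_, zero) , (Product.map₂ suc ∘ quotRem n) ]′ s))))
        (cong (λ z → ∑ (λ j → g (zero , j)) + z) (∑-remQuot m n (λ p → g (suc (proj₁ p) , proj₂ p))))

∑-product : ∀ {m n} (f : Vector ℤ m) (g : Vector ℤ n) → ∑ (λ i → ∑ (λ j → f i * g j)) ≡ ∑ f * ∑ g
∑-product f g = trans (∑-cong (λ i → ∑-*ˡ (f i) g)) (∑-*ʳ (∑ g) f)

-- Dot product; note that (A ⊗ B) i j is definitionally  dot (A i) (column j of B).
dot : ∀ {k} → Vector ℤ k → Vector ℤ k → ℤ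
dot a b = ∑ (λ l → a l * b l)

dot-congˡ : ∀ {k} {a a' : Vector ℤ k} (b : Vector ℤ k) → (∀ l → a l ≡ a' l) → dot a b ≡ dot a' b
dot-congˡ b e = ∑-cong (λ l → cong (_* b l) (e l))

dot-++ : ∀ {m n} (a b : Vector ℤ m) (a' b' : Vector ℤ n) → dot (a ++ a') (b ++ b') ≡ dot a b + dot a' b'
dot-++ {m} a b a' b' = ∑-splitAt m (λ s → [ a , a' ]′ s * [ b , b' ]′ s)

infixl 7 _⊗ᵥ_
_⊗ᵥ_ : ∀ {m n} → Vector ℤ m → Vector ℤ n → Vector ℤ (m ℕ.* n)
_⊗ᵥ_ {m} {n} a a' x = a (proj₁ (remQuot {m} n x)) * a' (proj₂ (remQuot {m} n x))

dot-⊗ᵥ : ∀ {m n} (a b : Vector ℤ m) (a' b' : Vector ℤ n) → dot (a ⊗ᵥ a') (b ⊗ᵥ b') ≡ dot a b * dot a' b'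
dot-⊗ᵥ {m} {n} a b a' b' = begin
    dot (a ⊗ᵥ a') (b ⊗ᵥ b')
  ≡⟨ ∑-remQuot m n (λ p → (a (proj₁ p) * a' (proj₂ p)) * (b (proj₁ p) * b' (proj₂ p))) ⟩
    ∑ (λ i → ∑ (λ j → (a i * a' j) * (b i * b' j)))
  ≡⟨ ∑-cong (λ i → ∑-cong (λ j → interchange (a i) (a' j) (b i) (b' j))) ⟩
    ∑ (λ i → ∑ (λ j → (a i * b i) * (a' j * b' j)))
  ≡⟨ ∑-product (λ i → a i * b i) (λ j → a' j * b' j) ⟩
    dot a b * dot a' b'
  ∎
  where
  open ≡-Reasoning
  interchange : ∀ w x y z → (w * x) * (y * z) ≡ (w * y) * (x * z)
  interchange = solve-∀

≈-refl : ∀ {k} {A : Mat k} → A ≈ A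
≈-refl _ _ = refl

≈-trans : ∀ {k} {A B C : Mat k} → A ≈ B → B ≈ C → A ≈ C
≈-trans e f i j = trans (e i j) (f i j)

⊗-cong : ∀ {k} {A A' B B' : Mat k} → A ≈ A' → B ≈ B' → (A ⊗ B) ≈ (A' ⊗ B')
⊗-cong eA eB i j = ∑-cong (λ l → cong₂ _*_ (eA i l) (eB l j))

·-⊗ : ∀ {k} (c : ℤ) (A B : Mat k) → ((c · A) ⊗ B) ≈ (c · (A ⊗ B))
·-⊗ c A B i j = trans (∑-cong (λ l → ℤP.*-assoc c (A i l) (B l j))) (∑-*ˡ c (λ l → A i l * B l j))

I-diag : ∀ {k} (i : Fin k) → I i i ≡ + 1
I-diag i with i ≟ i
... | yes _ = refl
... | no i≢i = ⊥-elim (i≢i refl)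

I-offDiag : ∀ {k} {i j : Fin k} → i ≢ j → I i j ≡ + 0
I-offDiag {i = i} {j} i≢j with i ≟ j
... | yes i≡j = ⊥-elim (i≢j i≡j)
... | no _    = refl

E-last : ∀ n → E n zero (fromℕ n) ≡ + 1
E-last n with fromℕ n ≟ fromℕ n
... | yes _ = refl
... | no ne = ⊥-elim (ne refl)

E-offLast : ∀ n {j} → j ≢ fromℕ n → E n zero j ≡ + 0
E-offLast n {j} j≢last with j ≟ fromℕ n
... | yes j≡last = ⊥-elim (j≢last j≡last)
... | no _       = refl

module _ {m n k} (F : Mat m → Mat n → Mat k)
         (F-I : I ≈ F I I)
         (F-⊗ : ∀ X Y X' Y' → (F X Y ⊗ F X' Y') ≈ F (X ⊗ X') (Y ⊗ Y')) where

  pow-hom : ∀ (X : Mat m) (Y : Mat n) a → (F X Y ^ a) ≈ F (X ^ a) (Y ^ a)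
  pow-hom X Y zero    = F-I
  pow-hom X Y (suc a) = ≈-trans (⊗-cong (pow-hom X Y a) ≈-refl) (F-⊗ (X ^ a) (Y ^ a) X Y)

  word-hom : ∀ {t} (M N : Mat m) (M' N' : Mat n) (a : Vec ℕ (suc t)) →
    word (F M M') (F N N') a ≈ F (word M N a) (word M' N' a)
  word-hom M N M' N' (a ∷ [])     = pow-hom M M' a
  word-hom M N M' N' (a ∷ b ∷ as) =
    ≈-trans (⊗-cong (≈-trans (⊗-cong (pow-hom M M' a) ≈-refl) (F-⊗ (M ^ a) (M' ^ a) N N'))
                    (word-hom M N M' N' (b ∷ as)))
            (F-⊗ (M ^ a ⊗ N) (M' ^ a ⊗ N') (word M N (b ∷ as)) (word M' N' (b ∷ as)))

blockEntry : ∀ {m n} → Mat m → Mat n → Fin m ⊎ Fin n → Fin m ⊎ Fin n → ℤ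
blockEntry X Y (inj₁ i) (inj₁ j) = X i j
blockEntry X Y (inj₂ i) (inj₂ j) = Y i j
blockEntry X Y _        _        = + 0

infixl 6 _⊕_
_⊕_ : ∀ {m n} → Mat m → Mat n → Mat (m ℕ.+ n)
_⊕_ {m} X Y x y = blockEntry X Y (splitAt m x) (splitAt m y)

⊕-⊗ : ∀ {m n} (X : Mat m) (Y : Mat n) X' Y' → ((X ⊕ Y) ⊗ (X' ⊕ Y')) ≈ ((X ⊗ X') ⊕ (Y ⊗ Y'))
⊕-⊗ {m} {n} X Y X' Y' x y =
  trans (∑-splitAt m (λ s → blockEntry X Y (splitAt m x) s * blockEntry X' Y' s (splitAt m y)))
        (blocks (splitAt m x) (splitAt m y))
  where
  blocks : ∀ s s' → ∑ (λ i → blockEntry X Y s (inj₁ i) * blockEntry X' Y' (inj₁ i) s')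
                    + ∑ (λ j → blockEntry X Y s (inj₂ j) * blockEntry X' Y' (inj₂ j) s')
                  ≡ blockEntry (X ⊗ X') (Y ⊗ Y') s s'
  blocks (inj₁ i) (inj₁ j) = trans (cong (λ z → (X ⊗ X') i j + z) (∑-0 n)) (ℤP.+-identityʳ _)
  blocks (inj₁ i) (inj₂ j) = cong₂ _+_ (∑-*0 (X i)) (∑-0 n)
  blocks (inj₂ i) (inj₁ j) = cong₂ _+_ (∑-0 m) (∑-*0 (Y i))
  blocks (inj₂ i) (inj₂ j) = trans (cong (_+ (Y ⊗ Y') i j) (∑-0 m)) (ℤP.+-identityˡ _)

splitAt-injective : ∀ m {n} {x y : Fin (m ℕ.+ n)} → splitAt m x ≡ splitAt m y → x ≡ y
splitAt-injective m {n} {x} {y} e =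
  trans (sym (FinP.join-splitAt m n x)) (trans (cong (join m n) e) (FinP.join-splitAt m n y))

⊕-I : ∀ {m n} → I ≈ (I {m} ⊕ I {n})
⊕-I {m} {n} x y with x ≟ y
... | yes refl = sym (onDiagonal (splitAt m x))
  where
  onDiagonal : ∀ s → blockEntry I I s s ≡ + 1
  onDiagonal (inj₁ i) = I-diag i
  onDiagonal (inj₂ j) = I-diag j
... | no x≢y = sym (offDiagonal (splitAt m x) (splitAt m y) (x≢y ∘ splitAt-injective m))
  where
  offDiagonal : ∀ s s' → s ≢ s' → blockEntry I I s s' ≡ + 0
  offDiagonal (inj₁ i) (inj₁ j) s≢s' = I-offDiag (s≢s' ∘ cong inj₁)
  offDiagonal (inj₁ i) (inj₂ j) _    = refl
  offDiagonal (inj₂ i) (inj₁ j) _    = refl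
  offDiagonal (inj₂ i) (inj₂ j) s≢s' = I-offDiag (s≢s' ∘ cong inj₂)

UT-⊕ : ∀ {m n} {X : Mat m} {Y : Mat n} → UpperTri X → UpperTri Y → UpperTri (X ⊕ Y)
UT-⊕ {m} {n} {X} {Y} utX utY x y y<x =
  below (splitAt m x) (splitAt m y)
        (subst₂ ℕ._<_ (toℕ-splitAt y) (toℕ-splitAt x) y<x)
  where
  toℕ-splitAt : ∀ z → toℕ z ≡ toℕ (join m n (splitAt m z))
  toℕ-splitAt z = cong toℕ (sym (FinP.join-splitAt m n z))
  below : ∀ s s' → toℕ (join m n s') ℕ.< toℕ (join m n s) → blockEntry X Y s s' ≡ + 0
  below (inj₁ i) (inj₁ j) lt = utX i j (subst₂ ℕ._<_ (FinP.toℕ-↑ˡ j n) (FinP.toℕ-↑ˡ i n) lt)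
  below (inj₁ i) (inj₂ j) _  = refl
  below (inj₂ i) (inj₁ j) _  = refl
  below (inj₂ i) (inj₂ j) lt =
    utY i j (ℕP.+-cancelˡ-< m (toℕ j) (toℕ i) (subst₂ ℕ._<_ (FinP.toℕ-↑ʳ m j) (FinP.toℕ-↑ʳ m i) lt))

-- Kronecker product, indexed through remQuot : Fin (m * n) → Fin m × Fin n;
-- its rows are tensor products of rows:  (X ⊠ Y) x ≡ X (x₁) ⊗ᵥ Y (x₂).
infixl 7 _⊠_
_⊠_ : ∀ {m n} → Mat m → Mat n → Mat (m ℕ.* n)
_⊠_ {m} {n} X Y x y =
  X (proj₁ (remQuot {m} n x)) (proj₁ (remQuot {m} n y)) * Y (proj₂ (remQuot {m} n x)) (proj₂ (remQuot {m} n y))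

⊠-⊗ : ∀ {m n} (X : Mat m) (Y : Mat n) X' Y' → ((X ⊠ Y) ⊗ (X' ⊠ Y')) ≈ ((X ⊗ X') ⊠ (Y ⊗ Y'))
⊠-⊗ {m} {n} X Y X' Y' x y =
  dot-⊗ᵥ (X (proj₁ (remQuot {m} n x))) (λ l → X' l (proj₁ (remQuot {m} n y)))
         (Y (proj₂ (remQuot {m} n x))) (λ l → Y' l (proj₂ (remQuot {m} n y)))

remQuot-injective : ∀ {m} n {x y : Fin (m ℕ.* n)} → remQuot {m} n x ≡ remQuot n y → x ≡ y
remQuot-injective {m} n {x} {y} e =
  trans (sym (FinP.combine-remQuot {m} n x)) (trans (cong (Product.uncurry combine) e) (FinP.combine-remQuot {m} n y))

⊠-I : ∀ {m n} → I ≈ (I {m} ⊠ I {n})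
⊠-I {m} {n} x y with x ≟ y
... | yes refl = sym (cong₂ _*_ (I-diag (proj₁ (remQuot {m} n x))) (I-diag (proj₂ (remQuot {m} n x))))
... | no x≢y = sym (offDiagonal (remQuot {m} n x) (remQuot {m} n y) (x≢y ∘ remQuot-injective n))
  where
  offDiagonal : ∀ (p p' : Fin m × Fin n) → p ≢ p' → I (proj₁ p) (proj₁ p') * I (proj₂ p) (proj₂ p') ≡ + 0
  offDiagonal (i , j) (i' , j') p≢p' with i ≟ i'
  ... | no _     = refl
  ... | yes refl = cong (λ z → + 1 * z) (I-offDiag (p≢p' ∘ cong (i ,_)))

-- Kronecker products of upper-triangular matrices are upper triangular
-- (combine orders Fin m × Fin n lexicographically).
UT-⊠ : ∀ {m n} {X : Mat m} {Y : Mat n} → UpperTri X → UpperTri Y → UpperTri (X ⊠ Y)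
UT-⊠ {m} {n} {X} {Y} utX utY x y y<x =
  below (remQuot {m} n x) (remQuot {m} n y) (subst₂ ℕ._<_ (toℕ-remQuot y) (toℕ-remQuot x) y<x)
  where
  toℕ-remQuot : ∀ z → toℕ z ≡ toℕ (Product.uncurry combine (remQuot {m} n z))
  toℕ-remQuot z = cong toℕ (sym (FinP.combine-remQuot {m} n z))
  below : ∀ (p p' : Fin m × Fin n) → toℕ (combine (proj₁ p') (proj₂ p')) ℕ.< toℕ (combine (proj₁ p) (proj₂ p)) →
          X (proj₁ p) (proj₁ p') * Y (proj₂ p) (proj₂ p') ≡ + 0
  below (i , j) (i' , j') lt with FinP.<-cmp i i'
  ... | tri< i<i' _ _ = ⊥-elim (ℕP.<-asym lt (FinP.combine-monoˡ-< j j' i<i'))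
  ... | tri> _ _ i'<i = cong (_* Y j j') (utX i i' i'<i)
  ... | tri≈ _ refl _ =
    trans (cong (X i i *_) (utY j j' (ℕP.+-cancelˡ-< (n ℕ.* toℕ i) (toℕ j') (toℕ j)
                  (subst₂ ℕ._<_ (FinP.toℕ-combine i j') (FinP.toℕ-combine i j) lt))))
          (ℤP.*-zeroʳ (X i i))

infixl 7 _⊙_
_⊙_ : ∀ {k} → Vector ℤ k → Mat k → Vector ℤ k
(u ⊙ W) j = dot u (λ l → W l j)

form : ∀ {k} → Vector ℤ k → Mat k → Vector ℤ k → ℤ
form u W v = dot (u ⊙ W) v

form-cong : ∀ {k} (u : Vector ℤ k) {W W' : Mat k} (v : Vector ℤ k) → W ≈ W' → form u W v ≡ form u W' v
form-cong u v W≈W' = dot-congˡ v (λ j → ∑-cong (λ l → cong (u l *_) (W≈W' l j)))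

form-⊕ : ∀ {m n} (u v : Vector ℤ m) (W : Mat m) (u' v' : Vector ℤ n) (W' : Mat n) →
  form (u ++ u') (W ⊕ W') (v ++ v') ≡ form u W v + form u' W' v'
form-⊕ {m} {n} u v W u' v' W' =
  trans (dot-congˡ (v ++ v') rowTimesBlocks) (dot-++ (u ⊙ W) v (u' ⊙ W') v')
  where
  columns : ∀ s' → ∑ (λ i → u i * blockEntry W W' (inj₁ i) s') + ∑ (λ j → u' j * blockEntry W W' (inj₂ j) s')
                 ≡ [ u ⊙ W , u' ⊙ W' ]′ s'
  columns (inj₁ j) = trans (cong (λ z → (u ⊙ W) j + z) (∑-*0 u')) (ℤP.+-identityʳ _)
  columns (inj₂ j) = trans (cong (_+ (u' ⊙ W') j) (∑-*0 u)) (ℤP.+-identityˡ _)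
  rowTimesBlocks : ∀ y → ((u ++ u') ⊙ (W ⊕ W')) y ≡ ((u ⊙ W) ++ (u' ⊙ W')) y
  rowTimesBlocks y = trans (∑-splitAt m (λ s → [ u , u' ]′ s * blockEntry W W' s (splitAt m y)))
                           (columns (splitAt m y))

form-⊠ : ∀ {m n} (u v : Vector ℤ m) (W : Mat m) (u' v' : Vector ℤ n) (W' : Mat n) →
  form (u ⊗ᵥ u') (W ⊠ W') (v ⊗ᵥ v') ≡ form u W v * form u' W' v'
form-⊠ {m} {n} u v W u' v' W' =
  trans (dot-congˡ (v ⊗ᵥ v') rowTimesKron) (dot-⊗ᵥ (u ⊙ W) v (u' ⊙ W') v')
  where
  rowTimesKron : ∀ y → ((u ⊗ᵥ u') ⊙ (W ⊠ W')) y ≡ ((u ⊙ W) ⊗ᵥ (u' ⊙ W')) y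
  rowTimesKron y = dot-⊗ᵥ u (λ l → W l (proj₁ (remQuot {m} n y))) u' (λ l → W' l (proj₂ (remQuot {m} n y)))

rowMat : ∀ {k} → Vector ℤ k → Mat k
rowMat u zero    j = u j
rowMat u (suc i) j = + 0

colMat : ∀ n → Vector ℤ (suc n) → Mat (suc n)
colMat n v i j = v i * E n zero j

UT-rowMat : ∀ {k} (u : Vector ℤ k) → UpperTri (rowMat u)
UT-rowMat u zero    j ()
UT-rowMat u (suc i) j _ = refl

UT-colMat : ∀ n (v : Vector ℤ (suc n)) → UpperTri (colMat n v)
UT-colMat n v i j j<i = trans (cong (v i *_) (E-offLast n j≢last)) (ℤP.*-zeroʳ (v i))
  where
  -- the last column is never strictly left of any column
  j≢last : j ≢ fromℕ n
  j≢last j≡last = ℕP.<-irrefl refl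
    (ℕP.<-≤-trans (subst (ℕ._< toℕ i) (trans (cong toℕ j≡last) (FinP.toℕ-fromℕ n)) j<i)
                  (ℕP.≤-pred (FinP.toℕ<n i)))

lastCol : ∀ n → Mat (suc n) → Vector ℤ (suc n)
lastCol n B l = B l (fromℕ n)

-- If  A W B  is a multiple of E, the scalar is the bilinear form of the
-- first row of A and the last column of B (its entry in position (1, s)).
extract-form : ∀ {t} n (A M N B : Mat (suc n)) (p : Poly (suc t)) → Represents n A M N B p →
  ∀ a → form (A zero) (word M N a) (lastCol n B) ≡ eval p a
extract-form n A M N B p rep a =
  trans (rep a zero (fromℕ n)) (trans (cong (eval p a *_) (E-last n)) (ℤP.*-identityʳ (eval p a)))

rowMat-⊗-colMat : ∀ n (u v : Vector ℤ (suc n)) (W : Mat (suc n)) →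
  (rowMat u ⊗ W ⊗ colMat n v) ≈ (form u W v · E n)
rowMat-⊗-colMat n u v W zero j =
  trans (∑-cong (λ l → sym (ℤP.*-assoc ((u ⊙ W) l) (v l) (E n zero j))))
        (∑-*ʳ (E n zero j) (λ l → (u ⊙ W) l * v l))
rowMat-⊗-colMat n u v W (suc i) j =
  trans (∑-cong (λ l → cong (_* colMat n v l j) (∑-0 (suc n))))
        (trans (∑-0 (suc n)) (sym (ℤP.*-zeroʳ (form u W v))))

realise-form : ∀ {t} n (u v : Vector ℤ (suc n)) (M N : Mat (suc n)) (p : Poly (suc t)) →
  (∀ a → form u (word M N a) v ≡ eval p a) → Represents n (rowMat u) M N (colMat n v) p
realise-form n u v M N p hyp a i j =
  trans (rowMat-⊗-colMat n u v (word M N a) i j) (cong (_* E n i j) (hyp a))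

UTRepresentable : ∀ {t} → Poly (suc t) → Set
UTRepresentable p = Σ ℕ λ n → Σ (Mat (suc n)) λ A → Σ (Mat (suc n)) λ M → Σ (Mat (suc n)) λ N →
  Σ (Mat (suc n)) λ B → AllUT A M N B × Represents n A M N B p

sum-representable : ∀ {t} (p₁ p₂ : Poly (suc t))
  (n₁ : ℕ) (A₁ M₁ N₁ B₁ : Mat (suc n₁)) → UpperTri M₁ → UpperTri N₁ → Represents n₁ A₁ M₁ N₁ B₁ p₁ →
  (n₂ : ℕ) (A₂ M₂ N₂ B₂ : Mat (suc n₂)) → UpperTri M₂ → UpperTri N₂ → Represents n₂ A₂ M₂ N₂ B₂ p₂ →
  UTRepresentable (p₁ :+ p₂)
sum-representable p₁ p₂ n₁ A₁ M₁ N₁ B₁ utM₁ utN₁ rep₁ n₂ A₂ M₂ N₂ B₂ utM₂ utN₂ rep₂ =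
  n₃ , rowMat u , M₁ ⊕ M₂ , N₁ ⊕ N₂ , colMat n₃ v ,
  (UT-rowMat u , UT-⊕ utM₁ utM₂ , UT-⊕ utN₁ utN₂ , UT-colMat n₃ v) ,
  realise-form n₃ u v (M₁ ⊕ M₂) (N₁ ⊕ N₂) (p₁ :+ p₂) sumForm
  where
  n₃ : ℕ
  n₃ = n₁ ℕ.+ suc n₂
  u v : Vector ℤ (suc n₃)
  u = A₁ zero ++ A₂ zero
  v = lastCol n₁ B₁ ++ lastCol n₂ B₂
  sumForm : ∀ a → form u (word (M₁ ⊕ M₂) (N₁ ⊕ N₂) a) v ≡ eval (p₁ :+ p₂) a
  sumForm a = begin
      form u (word (M₁ ⊕ M₂) (N₁ ⊕ N₂) a) v
    ≡⟨ form-cong u v (word-hom _⊕_ (⊕-I {suc n₁} {suc n₂}) ⊕-⊗ M₁ N₁ M₂ N₂ a) ⟩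
      form u (word M₁ N₁ a ⊕ word M₂ N₂ a) v
    ≡⟨ form-⊕ (A₁ zero) (lastCol n₁ B₁) (word M₁ N₁ a) (A₂ zero) (lastCol n₂ B₂) (word M₂ N₂ a) ⟩
      form (A₁ zero) (word M₁ N₁ a) (lastCol n₁ B₁) + form (A₂ zero) (word M₂ N₂ a) (lastCol n₂ B₂)
    ≡⟨ cong₂ _+_ (extract-form n₁ A₁ M₁ N₁ B₁ p₁ rep₁ a) (extract-form n₂ A₂ M₂ N₂ B₂ p₂ rep₂ a) ⟩
      eval p₁ a + eval p₂ a
    ∎
    where open ≡-Reasoning

product-representable : ∀ {t} (p₁ p₂ : Poly (suc t))
  (n₁ : ℕ) (A₁ M₁ N₁ B₁ : Mat (suc n₁)) → UpperTri M₁ → UpperTri N₁ → Represents n₁ A₁ M₁ N₁ B₁ p₁ →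
  (n₂ : ℕ) (A₂ M₂ N₂ B₂ : Mat (suc n₂)) → UpperTri M₂ → UpperTri N₂ → Represents n₂ A₂ M₂ N₂ B₂ p₂ →
  UTRepresentable (p₁ :* p₂)
product-representable p₁ p₂ n₁ A₁ M₁ N₁ B₁ utM₁ utN₁ rep₁ n₂ A₂ M₂ N₂ B₂ utM₂ utN₂ rep₂ =
  n₄ , rowMat u , M₁ ⊠ M₂ , N₁ ⊠ N₂ , colMat n₄ v ,
  (UT-rowMat u , UT-⊠ utM₁ utM₂ , UT-⊠ utN₁ utN₂ , UT-colMat n₄ v) ,
  realise-form n₄ u v (M₁ ⊠ M₂) (N₁ ⊠ N₂) (p₁ :* p₂) productForm
  where
  n₄ : ℕ
  n₄ = n₂ ℕ.+ n₁ ℕ.* suc n₂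
  u v : Vector ℤ (suc n₄)
  u = A₁ zero ⊗ᵥ A₂ zero
  v = lastCol n₁ B₁ ⊗ᵥ lastCol n₂ B₂
  productForm : ∀ a → form u (word (M₁ ⊠ M₂) (N₁ ⊠ N₂) a) v ≡ eval (p₁ :* p₂) a
  productForm a = begin
      form u (word (M₁ ⊠ M₂) (N₁ ⊠ N₂) a) v
    ≡⟨ form-cong u v (word-hom _⊠_ (⊠-I {suc n₁} {suc n₂}) ⊠-⊗ M₁ N₁ M₂ N₂ a) ⟩
      form u (word M₁ N₁ a ⊠ word M₂ N₂ a) v
    ≡⟨ form-⊠ (A₁ zero) (lastCol n₁ B₁) (word M₁ N₁ a) (A₂ zero) (lastCol n₂ B₂) (word M₂ N₂ a) ⟩
      form (A₁ zero) (word M₁ N₁ a) (lastCol n₁ B₁) * form (A₂ zero) (word M₂ N₂ a) (lastCol n₂ B₂)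
    ≡⟨ cong₂ _*_ (extract-form n₁ A₁ M₁ N₁ B₁ p₁ rep₁ a) (extract-form n₂ A₂ M₂ N₂ B₂ p₂ rep₂ a) ⟩
      eval p₁ a * eval p₂ a
    ∎
    where open ≡-Reasoning

UT-· : ∀ {k} (c : ℤ) {A : Mat k} → UpperTri A → UpperTri (c · A)
UT-· c utA i j j<i = trans (cong (c *_) (utA i j j<i)) (ℤP.*-zeroʳ c)

scale-represents : ∀ {t} n (c : ℤ) (A M N B : Mat (suc n)) (p : Poly (suc t)) →
  Represents n A M N B p → Represents n (c · A) M N B (con c :* p)
scale-represents n c A M N B p rep a i j = begin
    ((c · A) ⊗ word M N a ⊗ B) i j
  ≡⟨ ⊗-cong {B = B} (·-⊗ c A (word M N a)) ≈-refl i j ⟩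
    ((c · (A ⊗ word M N a)) ⊗ B) i j
  ≡⟨ ·-⊗ c (A ⊗ word M N a) B i j ⟩
    c * (A ⊗ word M N a ⊗ B) i j
  ≡⟨ cong (c *_) (rep a i j) ⟩
    c * (eval p a * E n i j)
  ≡⟨ sym (ℤP.*-assoc c (eval p a) (E n i j)) ⟩
    c * eval p a * E n i j
  ∎
  where open ≡-Reasoning

-- Lemma 5: (i) and (ii) need only M, N upper triangular, (iii) rescales A₁.
lemma5 : (t : ℕ) (p₁ p₂ : Poly (suc t))
    (n₁ : ℕ) (A₁ M₁ N₁ B₁ : Mat (suc n₁)) → AllUT A₁ M₁ N₁ B₁ → Represents n₁ A₁ M₁ N₁ B₁ p₁ →
    (n₂ : ℕ) (A₂ M₂ N₂ B₂ : Mat (suc n₂)) → AllUT A₂ M₂ N₂ B₂ → Represents n₂ A₂ M₂ N₂ B₂ p₂ →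
      (Σ ℕ λ n₃ → Σ (Mat (suc n₃)) λ A₃ → Σ (Mat (suc n₃)) λ M₃ → Σ (Mat (suc n₃)) λ N₃ → Σ (Mat (suc n₃)) λ B₃ →
         AllUT A₃ M₃ N₃ B₃ × Represents n₃ A₃ M₃ N₃ B₃ (p₁ :+ p₂))
      × (Σ ℕ λ n₄ → Σ (Mat (suc n₄)) λ A₄ → Σ (Mat (suc n₄)) λ M₄ → Σ (Mat (suc n₄)) λ N₄ → Σ (Mat (suc n₄)) λ B₄ →
         AllUT A₄ M₄ N₄ B₄ × Represents n₄ A₄ M₄ N₄ B₄ (p₁ :* p₂))
      × ((c : ℤ) → Σ (Mat (suc n₁)) λ A₅ → UpperTri A₅ × Represents n₁ A₅ M₁ N₁ B₁ (con c :* p₁))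
lemma5 t p₁ p₂ n₁ A₁ M₁ N₁ B₁ (utA₁ , utM₁ , utN₁ , _) rep₁ n₂ A₂ M₂ N₂ B₂ (_ , utM₂ , utN₂ , _) rep₂ =
  sum-representable p₁ p₂ n₁ A₁ M₁ N₁ B₁ utM₁ utN₁ rep₁ n₂ A₂ M₂ N₂ B₂ utM₂ utN₂ rep₂ ,
  product-representable p₁ p₂ n₁ A₁ M₁ N₁ B₁ utM₁ utN₁ rep₁ n₂ A₂ M₂ N₂ B₂ utM₂ utN₂ rep₂ ,
  λ c → c · A₁ , UT-· c utA₁ , scale-represents n₁ c A₁ M₁ N₁ B₁ p₁ rep₁
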